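{- Let $H$ and $K$ be digraphs such that $G=H\boxtimes K$ is thin. Then every non-Cartesian edge of $G$ is dispensable; consequently every edge of the Cartesian skeleton $\mathbb S(G)$ is Cartesian with respect to this factorization.
   Context: All digraphs are finite and simple without loops: $G=(V,E)$ with $E\subseteq\{(x,y)\in V\times V: x\neq y\}$; edges $(x,y)$ are written $xy$. Closed neighborhoods: $N^+[v]=\{x: vx\in E\}\cup\{v\}$, $N^-[v]=\{x: xv\in E\}\cup\{v\}$. A digraph is thin if for all distinct vertices $x,y$, $N^+[x]\neq N^+[y]$ or $N^-[x]\neq N^-[y]$. The strong product $H\boxtimes K$ has vertex set $V(H)\times V(K)$, with $(h,k)(h',k')$ an edge iff (i) $hh'\in E(H)$ and $k=k'$, or (ii) $kk'\in E(K)$ and $h=h'$, or (iii) $hh'\in E(H)$ and $kk'\in E(K)$; edges of type (i) or (ii) are Cartesian, the others non-Cartesian. In what follows $\subset$ denotes proper inclusion. For an edge $xy$ and a vertex $z$ of a digraph $G$: $xy$ satisfies the $N^+$-condition with $z$ if $(1^+)$ $N^+[x]\subset N^+[z]\subset N^+[y]$, or $(2^+)$ $N^+[y]\subset N^+[z]\subset N^+[x]$, or $(3^+)$ $N^+[x]\cap N^+[y]\subset N^+[x]\cap N^+[z]$ and $N^+[x]\cap N^+[y]\subset N^+[y]\cap N^+[z]$; $xy$ satisfies the weak $N^+$-condition with $z$ if $N^+[x]\cap N^+[y]\subseteq N^+[x]\cap N^+[z]$ and $N^+[x]\cap N^+[y]\subseteq N^+[y]\cap N^+[z]$. The conditions $(1^-),(2^-),(3^-)$,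 the $N^-$-condition and the weak $N^-$-condition are defined identically with $N^-$ in place of $N^+$. An edge $xy$ is dispensable if at least one holds: (D1) there is $z$ such that $xy$ satisfies the $N^+$-condition and the $N^-$-condition with $z$; (D2) there are $z_1,z_2$ such that (a) $xy$ satisfies $(3^+)$ with $z_1$ and the weak $N^-$-condition with $z_1$, and (b) $xy$ satisfies $(3^-)$ with $z_2$ and the weak $N^+$-condition with $z_2$; (D3) there is $z$ such that $xy$ satisfies the $N^+$-condition with $z$ and $N^-[x]=N^-[z]$ or $N^-[y]=N^-[z]$; (D4) there is $z$ such that $xy$ satisfies the $N^-$-condition with $z$ and $N^+[x]=N^+[z]$ or $N^+[y]=N^+[z]$; (D5) there are distinct vertices $z_1,z_2$, both distinct from $x$ and $y$, with $N^+[x]=N^+[z_1]$, $N^-[x]=N^-[z_2]$, $N^-[z_1]=N^-[y]$ and $N^+[z_2]=N^+[y]$. The Cartesian skeleton $\mathbb S(G)$ is the digraph with vertex set $V(G)$ and edge set $E(G)$ minus the set of dispensable edges. -}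

module Defs where

open import Data.Nat using (ℕ)
open import Data.Fin using (Fin)
open import Data.Bool using (Bool; true; false)
open import Data.Product using (Σ; ∃; _×_; _,_)
open import Data.Sum using (_⊎_)
open import Relation.Nullary using (¬_)
open import Relation.Binary.PropositionalEquality using (_≡_; _≢_)

record Digraph : Set where
  field
    n        : ℕ
    adj      : Fin n → Fin n → Bool
    loopless : ∀ x → adj x x ≡ false

open Digraph public

Edge : (D : Digraph) → Fin (n D) → Fin (n D) → Set
Edge D x y = adj D x y ≡ true

VSet : Set → Set₁
VSet V = V → Set

module _ {V : Set} where
  _⊆_ : VSet V → VSet V → Set
  A ⊆ B = ∀ x → A x → B x

  _≐_ : VSet V → VSet V → Set
  A ≐ B = (A ⊆ B) × (B ⊆ A)

  _⊂_ : VSet V → VSet V → Set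
  A ⊂ B = (A ⊆ B) × ¬ (B ⊆ A)

  _∩_ : VSet V → VSet V → VSet V
  (A ∩ B) x = A x × B x

module Notions {V : Set} (E : V → V → Set) where

  N⁺ : V → VSet V
  N⁺ v x = E v x ⊎ x ≡ v

  N⁻ : V → VSet V
  N⁻ v x = E x v ⊎ x ≡ v

  Thin : Set
  Thin = ∀ x y → x ≢ y → ¬ (N⁺ x ≐ N⁺ y) ⊎ ¬ (N⁻ x ≐ N⁻ y)

  Cond1 : (V → VSet V) → V → V → V → Set
  Cond1 N x y z = (N x ⊂ N z) × (N z ⊂ N y)

  Cond2 : (V → VSet V) → V → V → V → Set
  Cond2 N x y z = (N y ⊂ N z) × (N z ⊂ N x)

  Cond3 : (V → VSet V) → V → V → V → Set
  Cond3 N x y z = ((N x ∩ N y) ⊂ (N x ∩ N z)) × ((N x ∩ N y) ⊂ (N y ∩ N z))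

  NCond : (V → VSet V) → V → V → V → Set
  NCond N x y z = Cond1 N x y z ⊎ Cond2 N x y z ⊎ Cond3 N x y z

  WeakCond : (V → VSet V) → V → V → V → Set
  WeakCond N x y z = ((N x ∩ N y) ⊆ (N x ∩ N z)) × ((N x ∩ N y) ⊆ (N y ∩ N z))

  D1 : V → V → Set
  D1 x y = ∃ λ z → NCond N⁺ x y z × NCond N⁻ x y z

  D2 : V → V → Set
  D2 x y = (∃ λ z₁ → Cond3 N⁺ x y z₁ × WeakCond N⁻ x y z₁)
         × (∃ λ z₂ → Cond3 N⁻ x y z₂ × WeakCond N⁺ x y z₂)

  D3 : V → V → Set
  D3 x y = ∃ λ z → NCond N⁺ x y z × (N⁻ x ≐ N⁻ z ⊎ N⁻ y ≐ N⁻ z)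

  D4 : V → V → Set
  D4 x y = ∃ λ z → NCond N⁻ x y z × (N⁺ x ≐ N⁺ z ⊎ N⁺ y ≐ N⁺ z)

  D5 : V → V → Set
  D5 x y = Σ V λ z₁ → Σ V λ z₂ →
    z₁ ≢ z₂ × z₁ ≢ x × z₁ ≢ y × z₂ ≢ x × z₂ ≢ y ×
    (N⁺ x ≐ N⁺ z₁) × (N⁻ x ≐ N⁻ z₂) × (N⁻ z₁ ≐ N⁻ y) × (N⁺ z₂ ≐ N⁺ y)

  -- an edge xy is dispensable (the edge hypothesis E x y is stated separately)
  Dispensable : V → V → Set
  Dispensable x y = D1 x y ⊎ D2 x y ⊎ D3 x y ⊎ D4 x y ⊎ D5 x y

  SkelEdge : V → V → Set
  SkelEdge x y = E x y × ¬ Dispensable x y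

module _ (H K : Digraph) where
  PV : Set
  PV = Fin (n H) × Fin (n K)

  CartEdge : PV → PV → Set
  CartEdge (h , k) (h' , k') =
    (Edge H h h' × k ≡ k') ⊎ (Edge K k k' × h ≡ h')

  NonCartEdge : PV → PV → Set
  NonCartEdge (h , k) (h' , k') = Edge H h h' × Edge K k k'

  ⊠Edge : PV → PV → Set
  ⊠Edge x y = CartEdge x y ⊎ NonCartEdge x y

module Submission where

-- In H ⊠ K closed neighbourhoods are rectangles: N±[(h,k)] = N±[h] × N±[k].  A
-- non-Cartesian edge x = (h,k), y = (h',k') spans a square with the two further corners
-- z₁ = (h,k') and z₂ = (h',k).  Comparing N±[h] with N±[h'] and N±[k] with N±[k'],
-- either one pair of factors coincides, and then every corner has the neighbourhood of
-- x or of y, or the edge satisfies the neighbourhood condition at a corner: (1) or (2)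
-- at both corners when the two factor inclusions are strict in the same direction, and
-- (3) at a suitable corner otherwise.  Thinness forbids the same pair of factors to
-- coincide for N⁺ and for N⁻ (x would be a twin of a corner); each remaining combination
-- of the outcomes for N⁺ and N⁻ is one of D1–D5.

open import Defs
open import Data.Bool using (true)
import Data.Bool as Bool
open import Data.Empty using (⊥-elim)
open import Data.Fin using (Fin)
import Data.Fin as Fin
open import Data.Fin.Properties using (all?)
open import Data.Product using (_×_; _,_; proj₁; proj₂)
import Data.Product as Prod
open import Data.Sum using (_⊎_; inj₁; inj₂; [_,_])
import Data.Sum as Sum
open import Function using (_∘_)
open import Relation.Nullary using (¬_; Dec; yes; no)
open import Relation.Nullary.Decidable.Core using (_→-dec_; _⊎-dec_)
open import Relation.Unary using (Decidable; _⟨×⟩_)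
open import Relation.Binary.PropositionalEquality
  using (_≡_; _≢_; refl; sym; trans; cong; ≢-sym)

private variable
  W P Q : Set
  X X' Y Y' Z₁ Z₂ : VSet W
  A A' : VSet P
  B B' : VSet Q

≐-refl : X ≐ X
≐-refl = (λ _ p → p) , (λ _ p → p)

≐-sym : X ≐ Y → Y ≐ X
≐-sym (f , g) = g , f

⊆-resp-≐ : X ≐ X' → Y ≐ Y' → X ⊆ Y → X' ⊆ Y'
⊆-resp-≐ (_ , X'⊆X) (Y⊆Y' , _) X⊆Y v = Y⊆Y' v ∘ X⊆Y v ∘ X'⊆X v

⊂-resp-≐ : X ≐ X' → Y ≐ Y' → X ⊂ Y → X' ⊂ Y'
⊂-resp-≐ eX eY (X⊆Y , Y⊈X) =
  ⊆-resp-≐ eX eY X⊆Y , Y⊈X ∘ ⊆-resp-≐ (≐-sym eY) (≐-sym eX)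

≐-resp-≐ : X ≐ X' → Y ≐ Y' → X ≐ Y → X' ≐ Y'
≐-resp-≐ eX eY (X⊆Y , Y⊆X) = ⊆-resp-≐ eX eY X⊆Y , ⊆-resp-≐ eY eX Y⊆X

∩-cong : X ≐ X' → Y ≐ Y' → (X ∩ Y) ≐ (X' ∩ Y')
∩-cong (f , g) (f' , g') = (λ v → Prod.map (f v) (f' v)) , (λ v → Prod.map (g v) (g' v))

-- The conditions of Notions with N x, N y, N z abstracted to sets X, Y, Z:
-- Notions.NCond E N x y z unfolds to NCond (N x) (N y) (N z), and likewise for the others.
Cond1 Cond2 Cond3 WeakCond NCond : VSet W → VSet W → VSet W → Set
Cond1 X Y Z = (X ⊂ Z) × (Z ⊂ Y)
Cond2 X Y Z = (Y ⊂ Z) × (Z ⊂ X)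
Cond3 X Y Z = ((X ∩ Y) ⊂ (X ∩ Z)) × ((X ∩ Y) ⊂ (Y ∩ Z))
WeakCond X Y Z = ((X ∩ Y) ⊆ (X ∩ Z)) × ((X ∩ Y) ⊆ (Y ∩ Z))
NCond X Y Z = Cond1 X Y Z ⊎ Cond2 X Y Z ⊎ Cond3 X Y Z

module _ {W : Set} {X X' Y Y' Z Z' : VSet W} (eX : X ≐ X') (eY : Y ≐ Y') (eZ : Z ≐ Z') where

  Cond3-resp-≐ : Cond3 X Y Z → Cond3 X' Y' Z'
  Cond3-resp-≐ = Prod.map (⊂-resp-≐ (∩-cong eX eY) (∩-cong eX eZ))
                          (⊂-resp-≐ (∩-cong eX eY) (∩-cong eY eZ))

  WeakCond-resp-≐ : WeakCond X Y Z → WeakCond X' Y' Z'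
  WeakCond-resp-≐ = Prod.map (⊆-resp-≐ (∩-cong eX eY) (∩-cong eX eZ))
                             (⊆-resp-≐ (∩-cong eX eY) (∩-cong eY eZ))

  NCond-resp-≐ : NCond X Y Z → NCond X' Y' Z'
  NCond-resp-≐ = Sum.map (Prod.map (⊂-resp-≐ eX eZ) (⊂-resp-≐ eZ eY))
                 (Sum.map (Prod.map (⊂-resp-≐ eY eZ) (⊂-resp-≐ eZ eX)) Cond3-resp-≐)

-- X, Y are the neighbourhoods of the endpoints of an edge, Z₁, Z₂ those of the two
-- other corners of the square it spans in a product.
data CornerCondition (X Y Z₁ Z₂ : VSet W) : Set where
  chains : NCond X Y Z₁ → NCond X Y Z₂ → CornerCondition X Y Z₁ Z₂
  meet₁  : Cond3 X Y Z₁ → CornerCondition X Y Z₁ Z₂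
  meet₂  : Cond3 X Y Z₂ → CornerCondition X Y Z₁ Z₂

data SquareShape (X Y Z₁ Z₂ : VSet W) : Set where
  collapse₁ : X ≐ Z₁ → Y ≐ Z₂ → SquareShape X Y Z₁ Z₂
  collapse₂ : X ≐ Z₂ → Y ≐ Z₁ → SquareShape X Y Z₁ Z₂
  proper    : CornerCondition X Y Z₁ Z₂ → SquareShape X Y Z₁ Z₂

CornerCondition⇒NCond : CornerCondition X Y Z₁ Z₂ → NCond X Y Z₁ ⊎ NCond X Y Z₂
CornerCondition⇒NCond (chains c₁ _) = inj₁ c₁
CornerCondition⇒NCond (meet₁ c)     = inj₁ (inj₂ (inj₂ c))
CornerCondition⇒NCond (meet₂ c)     = inj₂ (inj₂ (inj₂ c))

module _ {W : Set} {X X' Y Y' Z₁ Z₁' Z₂ Z₂' : VSet W}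
         (eX : X ≐ X') (eY : Y ≐ Y') (e₁ : Z₁ ≐ Z₁') (e₂ : Z₂ ≐ Z₂') where

  CornerCondition-resp-≐ : CornerCondition X Y Z₁ Z₂ → CornerCondition X' Y' Z₁' Z₂'
  CornerCondition-resp-≐ (chains c₁ c₂) =
    chains (NCond-resp-≐ eX eY e₁ c₁) (NCond-resp-≐ eX eY e₂ c₂)
  CornerCondition-resp-≐ (meet₁ c)      = meet₁ (Cond3-resp-≐ eX eY e₁ c)
  CornerCondition-resp-≐ (meet₂ c)      = meet₂ (Cond3-resp-≐ eX eY e₂ c)

  SquareShape-resp-≐ : SquareShape X Y Z₁ Z₂ → SquareShape X' Y' Z₁' Z₂'
  SquareShape-resp-≐ (collapse₁ a b) = collapse₁ (≐-resp-≐ eX e₁ a) (≐-resp-≐ eY e₂ b)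
  SquareShape-resp-≐ (collapse₂ a b) = collapse₂ (≐-resp-≐ eX e₂ a) (≐-resp-≐ eY e₁ b)
  SquareShape-resp-≐ (proper c)      = proper (CornerCondition-resp-≐ c)

⟨×⟩-mono : A ⊆ A' → B ⊆ B' → (A ⟨×⟩ B) ⊆ (A' ⟨×⟩ B')
⟨×⟩-mono f g _ = Prod.map (f _) (g _)

⟨×⟩-cong : A ≐ A' → B ≐ B' → (A ⟨×⟩ B) ≐ (A' ⟨×⟩ B')
⟨×⟩-cong (f , f') (g , g') = ⟨×⟩-mono f g , ⟨×⟩-mono f' g'

⟨×⟩-⊆⇒⊆ˡ : ∀ {b} → B b → (A ⟨×⟩ B) ⊆ (A' ⟨×⟩ B) → A ⊆ A'
⟨×⟩-⊆⇒⊆ˡ {b = b} b∈B f a a∈A = proj₁ (f (a , b) (a∈A , b∈B))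

⟨×⟩-⊆⇒⊆ʳ : ∀ {a} → A a → (A ⟨×⟩ B) ⊆ (A ⟨×⟩ B') → B ⊆ B'
⟨×⟩-⊆⇒⊆ʳ {a = a} a∈A f b b∈B = proj₂ (f (a , b) (a∈A , b∈B))

⟨×⟩-⊂ˡ : ∀ {b} → B b → A ⊂ A' → (A ⟨×⟩ B) ⊂ (A' ⟨×⟩ B)
⟨×⟩-⊂ˡ b∈B (A⊆A' , A'⊈A) = ⟨×⟩-mono A⊆A' (λ _ p → p) , A'⊈A ∘ ⟨×⟩-⊆⇒⊆ˡ b∈B

⟨×⟩-⊂ʳ : ∀ {a} → A a → B ⊂ B' → (A ⟨×⟩ B) ⊂ (A ⟨×⟩ B')
⟨×⟩-⊂ʳ a∈A (B⊆B' , B'⊈B) = ⟨×⟩-mono (λ _ p → p) B⊆B' , B'⊈B ∘ ⟨×⟩-⊆⇒⊆ʳ a∈A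

module Square (A A' : VSet P) (B B' : VSet Q) {a₀ : P} {b₀ : Q}
              (a₀∈A : A a₀) (a₀∈A' : A' a₀) (b₀∈B : B b₀) (b₀∈B' : B' b₀) where

  Nx Ny Nz₁ Nz₂ : VSet (P × Q)
  Nx  = A ⟨×⟩ B
  Ny  = A' ⟨×⟩ B'
  Nz₁ = A ⟨×⟩ B'
  Nz₂ = A' ⟨×⟩ B

  weak₁ : WeakCond Nx Ny Nz₁
  weak₁ = (λ _ ((a , b) , (_ , b')) → (a , b) , (a , b'))
        , (λ _ ((a , _) , (a' , b')) → (a' , b') , (a , b'))

  weak₂ : WeakCond Nx Ny Nz₂
  weak₂ = (λ _ ((a , b) , (a' , _)) → (a , b) , (a' , b))
        , (λ _ ((_ , b) , (a' , b')) → (a' , b') , (a' , b))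

  Cond3₁ : ¬ (A ⊆ A') → ¬ (B' ⊆ B) → Cond3 Nx Ny Nz₁
  Cond3₁ A⊈A' B'⊈B =
      (proj₁ weak₁ , λ f → A⊈A' λ p a → proj₁ (proj₂ (f (p , b₀) ((a , b₀∈B) , (a , b₀∈B')))))
    , (proj₂ weak₁ , λ f → B'⊈B λ q b' → proj₂ (proj₁ (f (a₀ , q) ((a₀∈A' , b') , (a₀∈A , b')))))

  Cond3₂ : ¬ (A' ⊆ A) → ¬ (B ⊆ B') → Cond3 Nx Ny Nz₂
  Cond3₂ A'⊈A B⊈B' =
      (proj₁ weak₂ , λ f → B⊈B' λ q b → proj₂ (proj₂ (f (a₀ , q) ((a₀∈A , b) , (a₀∈A' , b)))))
    , (proj₂ weak₂ , λ f → A'⊈A λ p a' → proj₁ (proj₁ (f (p , b₀) ((a' , b₀∈B') , (a' , b₀∈B)))))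

  increasing : A ⊂ A' → B ⊂ B' → CornerCondition Nx Ny Nz₁ Nz₂
  increasing A⊂A' B⊂B' = chains
    (inj₁ (⟨×⟩-⊂ʳ a₀∈A B⊂B' , ⟨×⟩-⊂ˡ b₀∈B' A⊂A'))
    (inj₁ (⟨×⟩-⊂ˡ b₀∈B A⊂A' , ⟨×⟩-⊂ʳ a₀∈A' B⊂B'))

  decreasing : A' ⊂ A → B' ⊂ B → CornerCondition Nx Ny Nz₁ Nz₂
  decreasing A'⊂A B'⊂B = chains
    (inj₂ (inj₁ (⟨×⟩-⊂ˡ b₀∈B' A'⊂A , ⟨×⟩-⊂ʳ a₀∈A B'⊂B)))
    (inj₂ (inj₁ (⟨×⟩-⊂ʳ a₀∈A' B'⊂B , ⟨×⟩-⊂ˡ b₀∈B A'⊂A)))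

  shape : Dec (A ⊆ A') → Dec (A' ⊆ A) → Dec (B ⊆ B') → Dec (B' ⊆ B) → SquareShape Nx Ny Nz₁ Nz₂
  shape (yes A⊆A') (yes A'⊆A) _ _ =
    collapse₂ (⟨×⟩-cong (A⊆A' , A'⊆A) ≐-refl) (⟨×⟩-cong (A'⊆A , A⊆A') ≐-refl)
  shape _ _ (yes B⊆B') (yes B'⊆B) =
    collapse₁ (⟨×⟩-cong ≐-refl (B⊆B' , B'⊆B)) (⟨×⟩-cong ≐-refl (B'⊆B , B⊆B'))
  shape (no A⊈A') _ _ (no B'⊈B) = proper (meet₁ (Cond3₁ A⊈A' B'⊈B))
  shape _ (no A'⊈A) (no B⊈B') _ = proper (meet₂ (Cond3₂ A'⊈A B⊈B'))
  shape (yes A⊆A') (no A'⊈A) (yes B⊆B') (no B'⊈B) = proper (increasing (A⊆A' , A'⊈A) (B⊆B' , B'⊈B))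
  shape (no A⊈A') (yes A'⊆A) (no B⊈B') (yes B'⊆B) = proper (decreasing (A'⊆A , A⊈A') (B'⊆B , B⊈B'))

⊆-dec : ∀ {m} {A B : VSet (Fin m)} → Decidable A → Decidable B → Dec (A ⊆ B)
⊆-dec A? B? = all? (λ v → A? v →-dec B? v)

module _ (D : Digraph) where
  open Notions (Edge D) using (N⁺; N⁻)

  Edge-dec : ∀ a b → Dec (Edge D a b)
  Edge-dec a b = adj D a b Bool.≟ true

  Edge⇒≢ : ∀ {a b} → Edge D a b → a ≢ b
  Edge⇒≢ {a} e refl with () ← trans (sym e) (loopless D a)

  N⁺-⊆-dec : ∀ a b → Dec (N⁺ a ⊆ N⁺ b)
  N⁺-⊆-dec a b = ⊆-dec (λ v → Edge-dec a v ⊎-dec (v Fin.≟ a)) (λ v → Edge-dec b v ⊎-dec (v Fin.≟ b))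

  N⁻-⊆-dec : ∀ a b → Dec (N⁻ a ⊆ N⁻ b)
  N⁻-⊆-dec a b = ⊆-dec (λ v → Edge-dec v a ⊎-dec (v Fin.≟ a)) (λ v → Edge-dec v b ⊎-dec (v Fin.≟ b))

module _ (H K : Digraph) where
  open Notions (⊠Edge H K) using (N⁺; N⁻; Thin; Dispensable; D1; D2; D3; D4; D5)
  module NH = Notions (Edge H)
  module NK = Notions (Edge K)

  N⁺-⊠ : ∀ h k → (NH.N⁺ h ⟨×⟩ NK.N⁺ k) ≐ N⁺ (h , k)
  N⁺-⊠ h k = to , from
    where
    to : (NH.N⁺ h ⟨×⟩ NK.N⁺ k) ⊆ N⁺ (h , k)
    to _ (inj₁ e    , inj₁ e')   = inj₁ (inj₂ (e , e'))
    to _ (inj₁ e    , inj₂ refl) = inj₁ (inj₁ (inj₁ (e , refl)))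
    to _ (inj₂ refl , inj₁ e')   = inj₁ (inj₁ (inj₂ (e' , refl)))
    to _ (inj₂ refl , inj₂ refl) = inj₂ refl
    from : N⁺ (h , k) ⊆ (NH.N⁺ h ⟨×⟩ NK.N⁺ k)
    from _ (inj₁ (inj₁ (inj₁ (e , refl))))  = inj₁ e , inj₂ refl
    from _ (inj₁ (inj₁ (inj₂ (e' , refl)))) = inj₂ refl , inj₁ e'
    from _ (inj₁ (inj₂ (e , e')))           = inj₁ e , inj₁ e'
    from _ (inj₂ refl)                      = inj₂ refl , inj₂ refl

  N⁻-⊠ : ∀ h k → (NH.N⁻ h ⟨×⟩ NK.N⁻ k) ≐ N⁻ (h , k)
  N⁻-⊠ h k = to , from
    where
    to : (NH.N⁻ h ⟨×⟩ NK.N⁻ k) ⊆ N⁻ (h , k)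
    to _ (inj₁ e    , inj₁ e')   = inj₁ (inj₂ (e , e'))
    to _ (inj₁ e    , inj₂ refl) = inj₁ (inj₁ (inj₁ (e , refl)))
    to _ (inj₂ refl , inj₁ e')   = inj₁ (inj₁ (inj₂ (e' , refl)))
    to _ (inj₂ refl , inj₂ refl) = inj₂ refl
    from : N⁻ (h , k) ⊆ (NH.N⁻ h ⟨×⟩ NK.N⁻ k)
    from _ (inj₁ (inj₁ (inj₁ (e , refl))))  = inj₁ e , inj₂ refl
    from _ (inj₁ (inj₁ (inj₂ (e' , refl)))) = inj₂ refl , inj₁ e'
    from _ (inj₁ (inj₂ (e , e')))           = inj₁ e , inj₁ e'
    from _ (inj₂ refl)                      = inj₂ refl , inj₂ refl

  Thin⇒¬twins : Thin → ∀ {u v} → u ≢ v → N⁺ u ≐ N⁺ v → ¬ (N⁻ u ≐ N⁻ v)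
  Thin⇒¬twins thin u≢v eq⁺ eq⁻ = [ (λ ¬eq⁺ → ¬eq⁺ eq⁺) , (λ ¬eq⁻ → ¬eq⁻ eq⁻) ] (thin _ _ u≢v)

  module _ {h h' : Fin (n H)} {k k' : Fin (n K)} (e : Edge H h h') (e' : Edge K k k') where

    x y z₁ z₂ : PV H K
    x  = h , k
    y  = h' , k'
    z₁ = h , k'
    z₂ = h' , k

    z₁≢z₂ : z₁ ≢ z₂
    z₁≢z₂ = Edge⇒≢ H e ∘ cong proj₁
    z₁≢x : z₁ ≢ x
    z₁≢x = Edge⇒≢ K e' ∘ sym ∘ cong proj₂
    z₁≢y : z₁ ≢ y
    z₁≢y = Edge⇒≢ H e ∘ cong proj₁
    z₂≢x : z₂ ≢ x
    z₂≢x = Edge⇒≢ H e ∘ sym ∘ cong proj₁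
    z₂≢y : z₂ ≢ y
    z₂≢y = Edge⇒≢ K e' ∘ cong proj₂

    module S⁺ = Square (NH.N⁺ h) (NH.N⁺ h') (NK.N⁺ k) (NK.N⁺ k')
                       (inj₁ e) (inj₂ refl) (inj₁ e') (inj₂ refl)
    module S⁻ = Square (NH.N⁻ h) (NH.N⁻ h') (NK.N⁻ k) (NK.N⁻ k')
                       (inj₂ refl) (inj₁ e) (inj₂ refl) (inj₁ e')

    shape⁺ : SquareShape (N⁺ x) (N⁺ y) (N⁺ z₁) (N⁺ z₂)
    shape⁺ = SquareShape-resp-≐ (N⁺-⊠ h k) (N⁺-⊠ h' k') (N⁺-⊠ h k') (N⁺-⊠ h' k)
      (S⁺.shape (N⁺-⊆-dec H h h') (N⁺-⊆-dec H h' h) (N⁺-⊆-dec K k k') (N⁺-⊆-dec K k' k))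

    shape⁻ : SquareShape (N⁻ x) (N⁻ y) (N⁻ z₁) (N⁻ z₂)
    shape⁻ = SquareShape-resp-≐ (N⁻-⊠ h k) (N⁻-⊠ h' k') (N⁻-⊠ h k') (N⁻-⊠ h' k)
      (S⁻.shape (N⁻-⊆-dec H h h') (N⁻-⊆-dec H h' h) (N⁻-⊆-dec K k k') (N⁻-⊆-dec K k' k))

    weak⁺₂ : WeakCond (N⁺ x) (N⁺ y) (N⁺ z₂)
    weak⁺₂ = WeakCond-resp-≐ (N⁺-⊠ h k) (N⁺-⊠ h' k') (N⁺-⊠ h' k) S⁺.weak₂
    weak⁺₁ : WeakCond (N⁺ x) (N⁺ y) (N⁺ z₁)
    weak⁺₁ = WeakCond-resp-≐ (N⁺-⊠ h k) (N⁺-⊠ h' k') (N⁺-⊠ h k') S⁺.weak₁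
    weak⁻₁ : WeakCond (N⁻ x) (N⁻ y) (N⁻ z₁)
    weak⁻₁ = WeakCond-resp-≐ (N⁻-⊠ h k) (N⁻-⊠ h' k') (N⁻-⊠ h k') S⁻.weak₁
    weak⁻₂ : WeakCond (N⁻ x) (N⁻ y) (N⁻ z₂)
    weak⁻₂ = WeakCond-resp-≐ (N⁻-⊠ h k) (N⁻-⊠ h' k') (N⁻-⊠ h' k) S⁻.weak₂

    viaD1 : D1 x y → Dispensable x y
    viaD1 = inj₁
    viaD2 : D2 x y → Dispensable x y
    viaD2 = inj₂ ∘ inj₁
    viaD3 : D3 x y → Dispensable x y
    viaD3 = inj₂ ∘ inj₂ ∘ inj₁
    viaD4 : D4 x y → Dispensable x y
    viaD4 = inj₂ ∘ inj₂ ∘ inj₂ ∘ inj₁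
    viaD5 : D5 x y → Dispensable x y
    viaD5 = inj₂ ∘ inj₂ ∘ inj₂ ∘ inj₂

    EndpointTwin : (PV H K → VSet (PV H K)) → PV H K → Set
    EndpointTwin N z = N x ≐ N z ⊎ N y ≐ N z

    dispensable-by-D3 : CornerCondition (N⁺ x) (N⁺ y) (N⁺ z₁) (N⁺ z₂) →
      EndpointTwin N⁻ z₁ → EndpointTwin N⁻ z₂ → Dispensable x y
    dispensable-by-D3 c t₁ t₂ =
      [ (λ p → viaD3 (z₁ , p , t₁)) , (λ p → viaD3 (z₂ , p , t₂)) ] (CornerCondition⇒NCond c)

    dispensable-by-D4 : CornerCondition (N⁻ x) (N⁻ y) (N⁻ z₁) (N⁻ z₂) →
      EndpointTwin N⁺ z₁ → EndpointTwin N⁺ z₂ → Dispensable x y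
    dispensable-by-D4 c t₁ t₂ =
      [ (λ p → viaD4 (z₁ , p , t₁)) , (λ p → viaD4 (z₂ , p , t₂)) ] (CornerCondition⇒NCond c)

    dispensable-by-D1-D2 : CornerCondition (N⁺ x) (N⁺ y) (N⁺ z₁) (N⁺ z₂) →
      CornerCondition (N⁻ x) (N⁻ y) (N⁻ z₁) (N⁻ z₂) → Dispensable x y
    dispensable-by-D1-D2 (chains p₁ p₂) c⁻ =
      [ (λ q → viaD1 (z₁ , p₁ , q)) , (λ q → viaD1 (z₂ , p₂ , q)) ] (CornerCondition⇒NCond c⁻)
    dispensable-by-D1-D2 (meet₁ p) (chains q₁ _) = viaD1 (z₁ , inj₂ (inj₂ p) , q₁)
    dispensable-by-D1-D2 (meet₂ p) (chains _ q₂) = viaD1 (z₂ , inj₂ (inj₂ p) , q₂)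
    dispensable-by-D1-D2 (meet₁ p) (meet₁ q) = viaD1 (z₁ , inj₂ (inj₂ p) , inj₂ (inj₂ q))
    dispensable-by-D1-D2 (meet₂ p) (meet₂ q) = viaD1 (z₂ , inj₂ (inj₂ p) , inj₂ (inj₂ q))
    dispensable-by-D1-D2 (meet₁ p) (meet₂ q) = viaD2 ((z₁ , p , weak⁻₁) , (z₂ , q , weak⁺₂))
    dispensable-by-D1-D2 (meet₂ p) (meet₁ q) = viaD2 ((z₂ , p , weak⁻₂) , (z₁ , q , weak⁺₁))

    nonCartesian-dispensable : Thin → Dispensable x y
    nonCartesian-dispensable thin with shape⁺ | shape⁻
    ... | collapse₂ x≐z₂⁺ _ | collapse₂ x≐z₂⁻ _ = ⊥-elim (Thin⇒¬twins thin (≢-sym z₂≢x) x≐z₂⁺ x≐z₂⁻)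
    ... | collapse₁ x≐z₁⁺ _ | collapse₁ x≐z₁⁻ _ = ⊥-elim (Thin⇒¬twins thin (≢-sym z₁≢x) x≐z₁⁺ x≐z₁⁻)
    ... | collapse₂ x≐z₂⁺ y≐z₁⁺ | collapse₁ x≐z₁⁻ y≐z₂⁻ = viaD5 (z₂ , z₁ ,
          ≢-sym z₁≢z₂ , z₂≢x , z₂≢y , z₁≢x , z₁≢y , x≐z₂⁺ , x≐z₁⁻ , ≐-sym y≐z₂⁻ , ≐-sym y≐z₁⁺)
    ... | collapse₁ x≐z₁⁺ y≐z₂⁺ | collapse₂ x≐z₂⁻ y≐z₁⁻ = viaD5 (z₁ , z₂ ,
          z₁≢z₂ , z₁≢x , z₁≢y , z₂≢x , z₂≢y , x≐z₁⁺ , x≐z₂⁻ , ≐-sym y≐z₁⁻ , ≐-sym y≐z₂⁺)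
    ... | collapse₁ x≐z₁ y≐z₂ | proper c = dispensable-by-D4 c (inj₁ x≐z₁) (inj₂ y≐z₂)
    ... | collapse₂ x≐z₂ y≐z₁ | proper c = dispensable-by-D4 c (inj₂ y≐z₁) (inj₁ x≐z₂)
    ... | proper c | collapse₁ x≐z₁ y≐z₂ = dispensable-by-D3 c (inj₁ x≐z₁) (inj₂ y≐z₂)
    ... | proper c | collapse₂ x≐z₂ y≐z₁ = dispensable-by-D3 c (inj₂ y≐z₁) (inj₁ x≐z₂)
    ... | proper c⁺ | proper c⁻ = dispensable-by-D1-D2 c⁺ c⁻

lemma11 : (H K : Digraph) →
    Notions.Thin (⊠Edge H K) →
    (∀ x y → NonCartEdge H K x y → Notions.Dispensable (⊠Edge H K) x y)
    × (∀ x y → Notions.SkelEdge (⊠Edge H K) x y → CartEdge H K x y)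
lemma11 H K thin = nonCartesian⇒dispensable , skeleton⇒cartesian
  where
  nonCartesian⇒dispensable : ∀ x y → NonCartEdge H K x y → Notions.Dispensable (⊠Edge H K) x y
  nonCartesian⇒dispensable _ _ (e , e') = nonCartesian-dispensable H K e e' thin

  skeleton⇒cartesian : ∀ x y → Notions.SkelEdge (⊠Edge H K) x y → CartEdge H K x y
  skeleton⇒cartesian _ _ (inj₁ cartesian , _) = cartesian
  skeleton⇒cartesian x y (inj₂ nonCartesian , ¬dispensable) =
    ⊥-elim (¬dispensable (nonCartesian⇒dispensable x y nonCartesian))
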